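{- Let $G$ be a finite simple undirected graph, let $I_1,\dots,I_m$ be an enumeration without repetition of all largest stable sets of $G$, and let $G_s'$ be the graph with vertex set $N'=\{(v,i): 1\le i\le m,\ v\in I_i\}$ in which distinct vertices $(u,i),(v,j)$ are adjacent if and only if either ($u=v$ and $i\neq j$) or ($u\neq v$ and $uv\in E(G)$). For each $i$ let $I_i'=\{(v,i): v\in I_i\}$. Then every $I_i'$ ($1\le i\le m$) is a largest stable set of $G_s'$.
   Context: A stable set is a set of pairwise non-adjacent vertices; a largest stable set is one of maximum cardinality. -}

module Defs where

open import Data.Nat using (ℕ; zero; suc; _+_; _≤_)
open import Data.Fin using (Fin; zero; suc; _≟_)
open import Data.Fin.Subset using (Subset; _∈_; _⊆_; ∣_∣; ⊥)
open import Data.Product using (_×_; ∃)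
open import Data.Sum using (_⊎_)
open import Relation.Nullary using (¬_; yes; no)
open import Relation.Binary.PropositionalEquality using (_≡_; _≢_)
open import Function.Definitions using (Injective)

record Graph (n : ℕ) : Set₁ where
  field
    Adj    : Fin n → Fin n → Set
    sym    : ∀ {u v} → Adj u v → Adj v u
    irrefl : ∀ {v} → ¬ Adj v v
open Graph public

IsStable : ∀ {n} → Graph n → Subset n → Set
IsStable G S = ∀ u v → u ∈ S → v ∈ S → ¬ Adj G u v

IsLargestStable : ∀ {n} → Graph n → Subset n → Set
IsLargestStable G S = IsStable G S × (∀ T → IsStable G T → ∣ T ∣ ≤ ∣ S ∣)

IsEnumerationOfLargestStable : ∀ {n m} → Graph n → (Fin m → Subset n) → Set
IsEnumerationOfLargestStable G I =
  Injective _≡_ _≡_ I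
  × (∀ i → IsLargestStable G (I i))
  × (∀ S → IsLargestStable G S → ∃ λ i → I i ≡ S)

sumFin : ∀ m → (Fin m → ℕ) → ℕ
sumFin zero    f = 0
sumFin (suc m) f = f zero + sumFin m (λ i → f (suc i))

-- The graph G'_s.  Its vertex set N' = {(v,i) : v ∈ I i} is a subset of
-- Fin n × Fin m; adjacency of (u,i),(v,j):
AdjS' : ∀ {n m} → Graph n → Fin n × Fin m → Fin n × Fin m → Set
AdjS' G (u Data.Product., i) (v Data.Product., j) =
  (u ≡ v × i ≢ j) ⊎ (u ≢ v × Adj G u v)

-- A subset of N' is represented as a family S : Fin m → Subset n,
-- S i being {v : (v,i) ∈ S}; it must satisfy S i ⊆ I i.
SubsetN' : ∀ {n m} → (Fin m → Subset n) → (Fin m → Subset n) → Set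
SubsetN' I S = ∀ i → S i ⊆ I i

cardS' : ∀ {n m} → (Fin m → Subset n) → ℕ
cardS' {m = m} S = sumFin m (λ i → ∣ S i ∣)

-- stable set of G'_s (distinct vertices of S pairwise non-adjacent;
-- AdjS' is irreflexive so quantifying over all pairs is equivalent)
IsStableS' : ∀ {n m} → Graph n → (I S : Fin m → Subset n) → Set
IsStableS' G I S = SubsetN' I S ×
  (∀ u v i j → u ∈ S i → v ∈ S j → ¬ AdjS' G (u Data.Product., i) (v Data.Product., j))

IsLargestStableS' : ∀ {n m} → Graph n → (I S : Fin m → Subset n) → Set
IsLargestStableS' G I S =
  IsStableS' G I S × (∀ T → IsStableS' G I T → cardS' T ≤ cardS' S)

Iprime : ∀ {n m} → (Fin m → Subset n) → Fin m → (Fin m → Subset n)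
Iprime I i j with i ≟ j
... | yes _ = I i
... | no _  = ⊥

module Submission where

-- Stability of I_i' is immediate: its vertices all lie in the single layer i,
-- so two of them can only be adjacent through an edge uv of G inside I_i.
--
-- Maximality is a counting argument.  A subset T of N' is a family of layers
-- T_j = {v : (v,j) ∈ T}, and |T| = Σ_j |T_j|.  If T is stable in G'_s then
--   * the layers are pairwise disjoint, since (v,j) and (v,k) are adjacent
--     for j ≠ k, so  Σ_j |T_j| = |⋃_j T_j|;
--   * the union ⋃_j T_j is stable in G, since an edge uv of G between
--     (u,j) ∈ T and (v,k) ∈ T would be an edge of G'_s.
-- Hence |T| = |⋃_j T_j| ≤ α(G) = |I_i| = |I_i'|.

open import Defs hiding (sym)
open import Data.Nat using (ℕ; zero; suc; _+_; _≤_)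
open import Data.Nat.Properties using (≤-trans; m≤m+n; m≤n+m; +-suc; module ≤-Reasoning)
open import Data.Fin using (Fin; zero; suc; _≟_)
open import Data.Fin.Properties using (suc-injective)
open import Data.Fin.Subset using (Subset; _∈_; ∣_∣; ⊥; _∪_; inside; outside)
open import Data.Fin.Subset.Properties using (∉⊥; ∣⊥∣≡0; x∈p∪q⁻)
open import Data.Vec using ([]; _∷_; here; there)
open import Data.Product using (_×_; ∃; _,_; proj₁)
open import Data.Sum using (inj₁; inj₂)
open import Data.Empty using (⊥-elim) renaming (⊥ to Empty)
open import Relation.Nullary using (¬_; yes; no)
open import Relation.Binary.PropositionalEquality
  using (_≡_; refl; sym; cong; module ≡-Reasoning)

∣∪∣-disjoint : ∀ {n} (p q : Subset n) → (∀ {x} → x ∈ p → x ∈ q → Empty) →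
  ∣ p ∪ q ∣ ≡ ∣ p ∣ + ∣ q ∣
∣∪∣-disjoint []            []            _ = refl
∣∪∣-disjoint (outside ∷ p) (outside ∷ q) d = ∣∪∣-disjoint p q (λ a b → d (there a) (there b))
∣∪∣-disjoint (inside  ∷ p) (outside ∷ q) d = cong suc (∣∪∣-disjoint p q (λ a b → d (there a) (there b)))
∣∪∣-disjoint (outside ∷ p) (inside  ∷ q) d = begin
  suc ∣ p ∪ q ∣       ≡⟨ cong suc (∣∪∣-disjoint p q (λ a b → d (there a) (there b))) ⟩
  suc (∣ p ∣ + ∣ q ∣) ≡⟨ sym (+-suc ∣ p ∣ ∣ q ∣) ⟩
  ∣ p ∣ + suc ∣ q ∣   ∎
  where open ≡-Reasoning
∣∪∣-disjoint (inside  ∷ p) (inside  ∷ q) d = ⊥-elim (d here here)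

⋃Fin : ∀ {n} m → (Fin m → Subset n) → Subset n
⋃Fin zero    T = ⊥
⋃Fin (suc m) T = T zero ∪ ⋃Fin m (λ j → T (suc j))

∈-⋃Fin⁻ : ∀ {n} m (T : Fin m → Subset n) {x} → x ∈ ⋃Fin m T → ∃ λ j → x ∈ T j
∈-⋃Fin⁻ zero    T x∈ = ⊥-elim (∉⊥ x∈)
∈-⋃Fin⁻ (suc m) T x∈ with x∈p∪q⁻ (T zero) _ x∈
... | inj₁ x∈T₀ = zero , x∈T₀
... | inj₂ x∈⋃ with ∈-⋃Fin⁻ m (λ j → T (suc j)) x∈⋃
...   | j , x∈Tj = suc j , x∈Tj

PairwiseDisjoint : ∀ {n m} → (Fin m → Subset n) → Set
PairwiseDisjoint T = ∀ {j k x} → x ∈ T j → x ∈ T k → j ≡ k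

sum-∣∣-disjoint : ∀ {n} m (T : Fin m → Subset n) → PairwiseDisjoint T →
  sumFin m (λ j → ∣ T j ∣) ≡ ∣ ⋃Fin m T ∣
sum-∣∣-disjoint {n} zero T _ = sym (∣⊥∣≡0 n)
sum-∣∣-disjoint (suc m) T disj = begin
  ∣ T zero ∣ + sumFin m (λ j → ∣ T (suc j) ∣)
    ≡⟨ cong (∣ T zero ∣ +_) (sum-∣∣-disjoint m tail tail-disjoint) ⟩
  ∣ T zero ∣ + ∣ ⋃Fin m tail ∣
    ≡⟨ sym (∣∪∣-disjoint (T zero) (⋃Fin m tail) head-apart) ⟩
  ∣ ⋃Fin (suc m) T ∣ ∎
  where
  open ≡-Reasoning
  tail : Fin m → Subset _
  tail j = T (suc j)
  tail-disjoint : PairwiseDisjoint tail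
  tail-disjoint a b = suc-injective (disj a b)
  head-apart : ∀ {x} → x ∈ T zero → x ∈ ⋃Fin m tail → Empty
  head-apart x∈T₀ x∈⋃ with ∈-⋃Fin⁻ m tail x∈⋃
  ... | j , x∈Tj with disj x∈T₀ x∈Tj
  ...   | ()

≤-sumFin : ∀ m (f : Fin m → ℕ) i → f i ≤ sumFin m f
≤-sumFin (suc m) f zero    = m≤m+n (f zero) _
≤-sumFin (suc m) f (suc i) = ≤-trans (≤-sumFin m (λ j → f (suc j)) i) (m≤n+m _ (f zero))

NoEdgesS' : ∀ {n m} → Graph n → (Fin m → Subset n) → Set
NoEdgesS' G S = ∀ u v j k → u ∈ S j → v ∈ S k → ¬ AdjS' G (u , j) (v , k)

-- The layers of a stable set of G'_s are disjoint: copies (v,j), (v,k) of one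
-- vertex in distinct layers are adjacent.
layers-disjoint : ∀ {n m} (G : Graph n) (T : Fin m → Subset n) →
  NoEdgesS' G T → PairwiseDisjoint T
layers-disjoint G T noEdges {j} {k} {x} x∈Tj x∈Tk with j ≟ k
... | yes j≡k = j≡k
... | no  j≢k = ⊥-elim (noEdges x x j k x∈Tj x∈Tk (inj₁ (refl , j≢k)))

-- The projection ⋃_j T_j of a stable set of G'_s is stable in G: an edge uv
-- of G between members of T lifts to an edge of G'_s.
⋃-layers-stable : ∀ {n m} (G : Graph n) (T : Fin m → Subset n) →
  NoEdgesS' G T → IsStable G (⋃Fin m T)
⋃-layers-stable {m = m} G T noEdges u v u∈ v∈ uv
  with ∈-⋃Fin⁻ m T u∈ | ∈-⋃Fin⁻ m T v∈ | u ≟ v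
... | _ | _ | yes refl = irrefl G uv
... | j , u∈Tj | k , v∈Tk | no u≢v = noEdges u v j k u∈Tj v∈Tk (inj₂ (u≢v , uv))

stableS'-bounded : ∀ {n m} (G : Graph n) (T : Fin m → Subset n) (S : Subset n) →
  NoEdgesS' G T → IsLargestStable G S → cardS' T ≤ ∣ S ∣
stableS'-bounded {m = m} G T S noEdges (_ , S-max) = begin
  cardS' T         ≡⟨ sum-∣∣-disjoint m T (layers-disjoint G T noEdges) ⟩
  ∣ ⋃Fin m T ∣     ≤⟨ S-max (⋃Fin m T) (⋃-layers-stable G T noEdges) ⟩
  ∣ S ∣            ∎
  where open ≤-Reasoning

∈-Iprime⁻ : ∀ {n m} (I : Fin m → Subset n) i j {x} →
  x ∈ Iprime I i j → i ≡ j × x ∈ I i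
∈-Iprime⁻ I i j x∈ with i ≟ j
... | yes i≡j = i≡j , x∈
... | no  _   = ⊥-elim (∉⊥ x∈)

Iprime-diag : ∀ {n m} (I : Fin m → Subset n) i → Iprime I i i ≡ I i
Iprime-diag I i with i ≟ i
... | yes _   = refl
... | no  i≢i = ⊥-elim (i≢i refl)

Iprime-⊆N' : ∀ {n m} (I : Fin m → Subset n) i → SubsetN' I (Iprime I i)
Iprime-⊆N' I i j x∈ with ∈-Iprime⁻ I i j x∈
... | refl , x∈Ii = x∈Ii

-- If I_i is stable in G then I_i' has no edges of G'_s: both ends lie in
-- layer i, so an edge must come from an edge of G inside I_i.
Iprime-noEdges : ∀ {n m} (G : Graph n) (I : Fin m → Subset n) i →
  IsStable G (I i) → NoEdgesS' G (Iprime I i)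
Iprime-noEdges G I i stable u v j k u∈ v∈ edge
  with ∈-Iprime⁻ I i j u∈ | ∈-Iprime⁻ I i k v∈ | edge
... | refl , _     | refl , _     | inj₁ (_ , i≢i) = i≢i refl
... | refl , u∈Ii  | refl , v∈Ii  | inj₂ (_ , uv)  = stable u v u∈Ii v∈Ii uv

∣I∣≤cardS'-Iprime : ∀ {n m} (I : Fin m → Subset n) i → ∣ I i ∣ ≤ cardS' (Iprime I i)
∣I∣≤cardS'-Iprime {m = m} I i = begin
  ∣ I i ∣              ≡⟨ cong ∣_∣ (sym (Iprime-diag I i)) ⟩
  ∣ Iprime I i i ∣     ≤⟨ ≤-sumFin m (λ j → ∣ Iprime I i j ∣) i ⟩
  cardS' (Iprime I i)  ∎
  where open ≤-Reasoning

-- The theorem: only the fact that each I_i is a largest stable set is needed.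
lemma38 : ∀ {n m} (G : Graph n) (I : Fin m → Subset n) →
    IsEnumerationOfLargestStable G I →
    ∀ i → IsLargestStableS' G I (Iprime I i)
lemma38 G I (_ , largest , _) i = stable , maximum
  where
  stable : IsStableS' G I (Iprime I i)
  stable = Iprime-⊆N' I i , Iprime-noEdges G I i (proj₁ (largest i))
  maximum : ∀ T → IsStableS' G I T → cardS' T ≤ cardS' (Iprime I i)
  maximum T (_ , noEdges) =
    ≤-trans (stableS'-bounded G T (I i) noEdges (largest i)) (∣I∣≤cardS'-Iprime I i)
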